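{- Let $p>2$ be an odd prime, $G'$ a transitive group of degree $4$ whose order is coprime to $p$, and $H'$ a corresponding subgroup of $G'$. If there is an $H'$-extremal $\mathbb{F}_p$-representation of $G'$, then $p\equiv1\bmod 4$ and $G'\cong C_{4}$ (in particular $H'=\{1\}$).
   Context: A transitive group of degree $4$ is a subgroup of $\mathfrak{S}_4$ acting transitively on $\{1,2,3,4\}$; a corresponding subgroup is a point stabilizer. An $\mathbb{F}_p$-representation $(V,\rho)$ of $G'$ is $H'$-extremal if $\dim_{\mathbb{F}_p}V=2$, $V^{G'}=\{0\}$, and there is a 1-dimensional subspace $L\subset V$ with $H'\subset\mathrm{Stab}_{G'}(L)=\mathrm{Fix}_{G'}(L)$. -}

module Defs where

open import Data.Nat using (ℕ; zero; suc; NonZero)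
import Data.Nat as ℕ
open import Data.Nat.DivMod using (_mod_)
open import Data.Fin using (Fin; toℕ)
open import Data.Vec using (Vec; []; _∷_; lookup; map; allFin)
open import Data.List using (List; length; filter; concatMap; [_])
import Data.List as L
open import Data.Bool using (Bool; true; false)
open import Data.Product using (Σ; ∃; ∃-syntax; _×_; _,_)
open import Relation.Binary.PropositionalEquality using (_≡_; _≢_)
open import Relation.Nullary.Decidable using (does)
open import Data.Bool.Properties using (T?)
open import Data.Bool using (T)

-- The symmetric group 𝔖₄: a permutation σ is recorded by the vector of
-- its images (σ 0, σ 1, σ 2, σ 3).

Perm4 : Set
Perm4 = Vec (Fin 4) 4

-- (σ ∘ τ)(i) = σ (τ i)
_∘ₚ_ : Perm4 → Perm4 → Perm4
σ ∘ₚ τ = map (lookup σ) τ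

idₚ : Perm4
idₚ = allFin 4

IsBijection : Perm4 → Set
IsBijection σ = ∀ j → ∃[ i ] (lookup σ i ≡ j × ∀ i' → lookup σ i' ≡ j → i' ≡ i)

allFin4 : List (Fin 4)
allFin4 = Data.Vec.toList (allFin 4)

allVecs : (n : ℕ) → List (Vec (Fin 4) n)
allVecs zero = [ [] ]
allVecs (suc n) = concatMap (λ x → L.map (x ∷_) (allVecs n)) allFin4

record IsSubgroupS4 (G : Perm4 → Bool) : Set where
  field
    members-bij : ∀ σ → G σ ≡ true → IsBijection σ
    has-id      : G idₚ ≡ true
    closed-∘    : ∀ σ τ → G σ ≡ true → G τ ≡ true → G (σ ∘ₚ τ) ≡ true
    closed-inv  : ∀ σ → G σ ≡ true → ∃[ τ ] (G τ ≡ true × σ ∘ₚ τ ≡ idₚ)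

order : (Perm4 → Bool) → ℕ
order G = length (filter (λ σ → T? (G σ)) (allVecs 4))

IsTransitive : (Perm4 → Bool) → Set
IsTransitive G = ∀ i j → ∃[ σ ] (G σ ≡ true × lookup σ i ≡ j)

-- H = Stab_G(i): the "corresponding subgroup" (a point stabilizer)
InPointStab : (Perm4 → Bool) → Fin 4 → Perm4 → Set
InPointStab G i σ = G σ ≡ true × lookup σ i ≡ i

_+₄_ : Fin 4 → Fin 4 → Fin 4
a +₄ b = (toℕ a ℕ.+ toℕ b) mod 4

IsoToC4 : (Perm4 → Bool) → Set
IsoToC4 G = Σ (Fin 4 → Perm4) λ f →
    (∀ a → G (f a) ≡ true)
  × (∀ a b → f a ≡ f b → a ≡ b)
  × (∀ σ → G σ ≡ true → ∃[ a ] (f a ≡ σ))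
  × (∀ a b → f (a +₄ b) ≡ f a ∘ₚ f b)

module _ (p : ℕ) .{{_ : NonZero p}} where

  F : Set
  F = Fin p

  _+F_ : F → F → F
  a +F b = (toℕ a ℕ.+ toℕ b) mod p

  _*F_ : F → F → F
  a *F b = (toℕ a ℕ.* toℕ b) mod p

  0F : F
  0F = 0 mod p

  1F : F
  1F = 1 mod p

  record V2 : Set where
    constructor ⟨_,_⟩
    field x y : F

  zeroV : V2
  zeroV = ⟨ 0F , 0F ⟩

  _·V_ : F → V2 → V2
  c ·V ⟨ a , b ⟩ = ⟨ c *F a , c *F b ⟩

  record Mat2 : Set where
    constructor mat
    field a b c d : F

  I2 : Mat2
  I2 = mat 1F 0F 0F 1F

  _*M_ : Mat2 → Mat2 → Mat2
  mat a b c d *M mat a' b' c' d' =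
    mat ((a *F a') +F (b *F c')) ((a *F b') +F (b *F d'))
        ((c *F a') +F (d *F c')) ((c *F b') +F (d *F d'))

  _$M_ : Mat2 → V2 → V2
  mat a b c d $M ⟨ u , v ⟩ = ⟨ (a *F u) +F (b *F v) , (c *F u) +F (d *F v) ⟩

  record IsRep (G : Perm4 → Bool) (ρ : Perm4 → Mat2) : Set where
    field
      rep-id : ρ idₚ ≡ I2
      rep-∘  : ∀ σ τ → G σ ≡ true → G τ ≡ true → ρ (σ ∘ₚ τ) ≡ ρ σ *M ρ τ

  NoInvariants : (Perm4 → Bool) → (Perm4 → Mat2) → Set
  NoInvariants G ρ = ∀ v → (∀ σ → G σ ≡ true → ρ σ $M v ≡ v) → v ≡ zeroV

  InLine : V2 → V2 → Set
  InLine v w = ∃[ c ] (w ≡ c ·V v)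

  InStab : (Perm4 → Bool) → (Perm4 → Mat2) → V2 → Perm4 → Set
  InStab G ρ v σ = G σ ≡ true
    × (∀ w → InLine v w → InLine v (ρ σ $M w))
    × (∀ w → InLine v w → ∃[ u ] (InLine v u × ρ σ $M u ≡ w))

  InFix : (Perm4 → Bool) → (Perm4 → Mat2) → V2 → Perm4 → Set
  InFix G ρ v σ = G σ ≡ true × (∀ w → InLine v w → ρ σ $M w ≡ w)

  IsExtremal : (Perm4 → Bool) → Fin 4 → (Perm4 → Mat2) → Set
  IsExtremal G i ρ = NoInvariants G ρ
    × ∃[ v ] (v ≢ zeroV
      × (∀ σ → InPointStab G i σ → InStab G ρ v σ)
      × (∀ σ → (InStab G ρ v σ → InFix G ρ v σ) × (InFix G ρ v σ → InStab G ρ v σ)))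

-- Let v span the line L of the extremal representation.  Since
-- Stab(L) = Fix(L), no element of G maps v to -v, and since H ⊆ Stab(L),
-- H fixes v.  A transitive subgroup of 𝔖₄ either contains the Klein
-- group V₄ or is generated by a 4-cycle g; this is checked by computation.
--
-- If V₄ ⊆ G, then V₄ is a set of representatives of G/H, so the transfer
-- Σ_{u ∈ V₄} ρ(u) v is G-invariant and hence 0.  The three involutions ρ(u),
-- u ∈ V₄ ∖ {1}, have determinants ±1 whose product is 1, so one of them has
-- determinant 1 and is ±I; it cannot be -I, so it is I.  Then the transfer
-- is 2 (v + ρ(w) v) for some w ∈ V₄, which forces ρ(w) v = -v.
--
-- So G = ⟨g⟩ ≅ C₄ and H = 1.  With d = det ρ(g), the involution ρ(g²) has
-- determinant d² = ±1.  If d² = 1 then ρ(g²) = I as before, so v + ρ(g) v is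
-- invariant, hence 0, and again ρ(g) v = -v.  Thus d² = -1, and -1 is a
-- square mod p only if p ≡ 1 mod 4 (otherwise d = d^p = -d by Fermat).

module Submission where

open import Defs hiding (0F; 1F)

open import Algebra.Bundles using (CommutativeRing; CommutativeMonoid)
import Algebra.Definitions.RawMonoid
import Algebra.Properties.CommutativeMonoid.Sum
import Algebra.Properties.CommutativeSemiring.Binomial
import Algebra.Properties.Monoid.Sum
import Algebra.Properties.Ring
import Algebra.Properties.Semiring.Exp
import Algebra.Solver.CommutativeMonoid
import Algebra.Solver.Ring
open import Algebra.Solver.Ring.AlmostCommutativeRing using (fromCommutativeRing; _-Raw-AlmostCommutative⟶_)
open import Data.Bool using (Bool; true)
import Data.Bool as Bool
open import Data.Empty using (⊥; ⊥-elim)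
open import Data.Fin as Fin using (Fin; toℕ; zero; suc; fromℕ; inject₁)
open import Data.Fin.Patterns using (0F; 1F; 2F; 3F)
open import Data.Fin.Permutation using (Permutation′; permutation)
open import Data.Fin.Properties using (toℕ-fromℕ<; toℕ-injective; toℕ<n; toℕ-fromℕ; toℕ-inject₁; all?; any?)
open import Data.Integer as ℤ using (ℤ; -[1+_]; _⊖_; 0ℤ; 1ℤ)
import Data.Integer.Properties as ℤ
open import Data.List using (List; []; _∷_; _++_; filter; cartesianProductWith)
open import Data.List.Relation.Unary.All as All using (All; []; _∷_)
import Data.List.Relation.Unary.All.Properties as All
open import Data.List.Relation.Unary.Any as Any using (Any)
open import Data.List.Membership.Propositional using (find)
open import Data.List.Membership.Propositional.Properties using (∈-filter⁺)
open import Data.Maybe using (Maybe; map)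
open import Data.Nat as ℕ using (ℕ; NonZero; _<_)
open import Data.Nat.Coprimality using (Coprime)
open import Data.Nat.Combinatorics using (_C_; nCn≡1; k![n∸k]!∣n!)
open import Data.Nat.Combinatorics.Specification using (nCk≡n!/k![n-k]!)
open import Data.Nat.Divisibility using (_∣_; ∣1⇒≡1; divides; m%n≡0⇒n∣m; n∣m⇒m%n≡0; >⇒∤; m∣m*n)
open import Data.Nat.DivMod
  using (_mod_; _%_; m%n<n; m≡m%n+[m/n]*n; m∣n⇒o%n%m≡o%m; m/n*n≡m; %-distribˡ-+; %-distribˡ-*; m<n⇒m%n≡m; n%n≡0)
open import Data.Nat.Primality using (Prime; euclidsLemma; prime⇒¬composite; prime⇒nonZero; composite-≢; ¬prime[1])
import Data.Nat.Properties as ℕ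
open import Data.Product using (∃-syntax; _×_; _,_; proj₁; proj₂)
open import Data.Sum using (_⊎_; inj₁; inj₂; [_,_]′)
open import Data.Vec using ([]; _∷_; lookup)
open import Data.Vec.Properties using (≡-dec; lookup-map; map-cong; map-∘; map-id; lookup-allFin)
open import Function using (_∘_)
open import Level using (0ℓ)
open import Relation.Binary.Definitions using (DecidableEquality)
open import Relation.Binary.PropositionalEquality
  using (_≡_; _≢_; refl; sym; trans; cong; cong₂; subst; setoid; isEquivalence; module ≡-Reasoning)
open import Relation.Nullary using (¬_)
open import Relation.Nullary.Decidable using (Dec; yes; no; from-yes; dec⇒maybe; _⊎-dec_; _→-dec_)

prime∤m! : ∀ {p m} → Prime p → m < p → ¬ p ∣ m ℕ.!
prime∤m! {m = ℕ.zero}  p-prime _   p∣1  = ¬prime[1] (subst Prime (∣1⇒≡1 p∣1) p-prime)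
prime∤m! {m = ℕ.suc m} p-prime m<p p∣m! with euclidsLemma (ℕ.suc m) (m ℕ.!) p-prime p∣m!
... | inj₁ p∣1+m = >⇒∤ m<p p∣1+m
... | inj₂ p∣m!  = prime∤m! p-prime (ℕ.<-trans (ℕ.n<1+n m) m<p) p∣m!

p∣pCk : ∀ {p k} → Prime p → 0 < k → k < p → p ∣ p C k
p∣pCk {p@(ℕ.suc n)} {k} p-prime 0<k k<p =
  [ (λ p∣pCk → p∣pCk) , ⊥-elim ∘ p∤k!*[p∸k]! ]′
  (euclidsLemma (p C k) (k ℕ.! ℕ.* (p ℕ.∸ k) ℕ.!) p-prime p∣pCk*[k!*[p∸k]!])
  where
  pCk*[k!*[p∸k]!]≡p! : (p C k) ℕ.* (k ℕ.! ℕ.* (p ℕ.∸ k) ℕ.!) ≡ p ℕ.!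
  pCk*[k!*[p∸k]!]≡p! = trans (cong (ℕ._* (k ℕ.! ℕ.* (p ℕ.∸ k) ℕ.!)) (nCk≡n!/k![n-k]! {p} {k} (ℕ.<⇒≤ k<p)))
    (m/n*n≡m {{ℕ._!*_!≢0 k (p ℕ.∸ k)}} (k![n∸k]!∣n! (ℕ.<⇒≤ k<p)))
  p∣pCk*[k!*[p∸k]!] : p ∣ (p C k) ℕ.* (k ℕ.! ℕ.* (p ℕ.∸ k) ℕ.!)
  p∣pCk*[k!*[p∸k]!] = subst (p ∣_) (sym pCk*[k!*[p∸k]!]≡p!) (m∣m*n (n ℕ.!))
  p∤k!*[p∸k]! : ¬ p ∣ k ℕ.! ℕ.* (p ℕ.∸ k) ℕ.!
  p∤k!*[p∸k]! = [ prime∤m! p-prime k<p , prime∤m! p-prime (ℕ.∸-monoʳ-< 0<k (ℕ.<⇒≤ k<p)) ]′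
              ∘ euclidsLemma (k ℕ.!) ((p ℕ.∸ k) ℕ.!) p-prime

prime>2⇒2∤p : ∀ {p} → Prime p → 2 < p → ¬ 2 ∣ p
prime>2⇒2∤p p-prime 2<p =
  prime⇒¬composite p-prime ∘ composite-≢ 2 {{ℕ.nonTrivial}} {{prime⇒nonZero p-prime}} (ℕ.<⇒≢ 2<p)

prime>2⇒p%4≡1∨3 : ∀ {p} → Prime p → 2 < p → p % 4 ≡ 1 ⊎ p % 4 ≡ 3
prime>2⇒p%4≡1∨3 {p} p-prime 2<p with p % 4 | m%n<n p 4 | m∣n⇒o%n%m≡o%m 2 4 p (divides 2 refl)
... | 0 | _ | 0≡p%2 = ⊥-elim (prime>2⇒2∤p p-prime 2<p (m%n≡0⇒n∣m p 2 (sym 0≡p%2)))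
... | 1 | _ | _     = inj₁ refl
... | 2 | _ | 0≡p%2 = ⊥-elim (prime>2⇒2∤p p-prime 2<p (m%n≡0⇒n∣m p 2 (sym 0≡p%2)))
... | 3 | _ | _     = inj₂ refl
... | ℕ.suc (ℕ.suc (ℕ.suc (ℕ.suc _))) | ℕ.s<s (ℕ.s<s (ℕ.s<s (ℕ.s<s ()))) | _

module PrimeField (p : ℕ) .{{_ : NonZero p}} where

  open ≡-Reasoning

  [_] : ℕ → F p
  [ n ] = n mod p

  toℕ-[] : ∀ n → toℕ [ n ] ≡ n % p
  toℕ-[] n = toℕ-fromℕ< _

  []-toℕ : ∀ a → [ toℕ a ] ≡ a
  []-toℕ a = toℕ-injective (trans (toℕ-[] (toℕ a)) (m<n⇒m%n≡m (toℕ<n a)))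

  %≡⇒[]≡ : ∀ {m n} → m % p ≡ n % p → [ m ] ≡ [ n ]
  %≡⇒[]≡ {m} {n} e = toℕ-injective (trans (toℕ-[] m) (trans e (sym (toℕ-[] n))))

  []≡⇒%≡ : ∀ {m n} → [ m ] ≡ [ n ] → m % p ≡ n % p
  []≡⇒%≡ {m} {n} e = trans (sym (toℕ-[] m)) (trans (cong toℕ e) (toℕ-[] n))

  0%p≡0 : 0 % p ≡ 0
  0%p≡0 = m<n⇒m%n≡m (ℕ.>-nonZero⁻¹ p)

  infixl 6 _+_
  infixl 7 _*_
  infix 8 -_

  _+_ _*_ : F p → F p → F p
  _+_ = _+F_ p
  _*_ = _*F_ p

  -_ : F p → F p
  - a = [ p ℕ.∸ toℕ a ]

  0# 1# : F p
  0# = [ 0 ]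
  1# = [ 1 ]

  []-+ : ∀ m n → [ m ℕ.+ n ] ≡ [ m ] + [ n ]
  []-+ m n = %≡⇒[]≡ (trans (%-distribˡ-+ m n p) (sym (cong₂ (λ x y → (x ℕ.+ y) % p) (toℕ-[] m) (toℕ-[] n))))

  []-* : ∀ m n → [ m ℕ.* n ] ≡ [ m ] * [ n ]
  []-* m n = %≡⇒[]≡ (trans (%-distribˡ-* m n p) (sym (cong₂ (λ x y → (x ℕ.* y) % p) (toℕ-[] m) (toℕ-[] n))))

  []-elim : {P : F p → Set} → (∀ l → P [ l ]) → ∀ a → P a
  []-elim {P} h a = subst P ([]-toℕ a) (h (toℕ a))

  []-elim₂ : {P : F p → F p → Set} → (∀ l m → P [ l ] [ m ]) → ∀ a b → P a b
  []-elim₂ {P} h = []-elim {λ a → ∀ b → P a b} λ l → []-elim (h l)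

  []-elim₃ : {P : F p → F p → F p → Set} → (∀ l m n → P [ l ] [ m ] [ n ]) → ∀ a b c → P a b c
  []-elim₃ {P} h = []-elim {λ a → ∀ b c → P a b c} λ l → []-elim₂ (h l)

  +-assoc : ∀ a b c → (a + b) + c ≡ a + (b + c)
  +-assoc = []-elim₃ λ l m n → begin
    ([ l ] + [ m ]) + [ n ]   ≡⟨ cong (_+ [ n ]) ([]-+ l m) ⟨
    [ l ℕ.+ m ] + [ n ]       ≡⟨ []-+ (l ℕ.+ m) n ⟨
    [ l ℕ.+ m ℕ.+ n ]         ≡⟨ cong [_] (ℕ.+-assoc l m n) ⟩
    [ l ℕ.+ (m ℕ.+ n) ]       ≡⟨ []-+ l (m ℕ.+ n) ⟩
    [ l ] + [ m ℕ.+ n ]       ≡⟨ cong ([ l ] +_) ([]-+ m n) ⟩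
    [ l ] + ([ m ] + [ n ])   ∎

  *-assoc : ∀ a b c → (a * b) * c ≡ a * (b * c)
  *-assoc = []-elim₃ λ l m n → begin
    ([ l ] * [ m ]) * [ n ]   ≡⟨ cong (_* [ n ]) ([]-* l m) ⟨
    [ l ℕ.* m ] * [ n ]       ≡⟨ []-* (l ℕ.* m) n ⟨
    [ l ℕ.* m ℕ.* n ]         ≡⟨ cong [_] (ℕ.*-assoc l m n) ⟩
    [ l ℕ.* (m ℕ.* n) ]       ≡⟨ []-* l (m ℕ.* n) ⟩
    [ l ] * [ m ℕ.* n ]       ≡⟨ cong ([ l ] *_) ([]-* m n) ⟩
    [ l ] * ([ m ] * [ n ])   ∎

  *-distribˡ-+ : ∀ a b c → a * (b + c) ≡ a * b + a * c
  *-distribˡ-+ = []-elim₃ λ l m n → begin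
    [ l ] * ([ m ] + [ n ])       ≡⟨ cong ([ l ] *_) ([]-+ m n) ⟨
    [ l ] * [ m ℕ.+ n ]           ≡⟨ []-* l (m ℕ.+ n) ⟨
    [ l ℕ.* (m ℕ.+ n) ]           ≡⟨ cong [_] (ℕ.*-distribˡ-+ l m n) ⟩
    [ l ℕ.* m ℕ.+ l ℕ.* n ]       ≡⟨ []-+ (l ℕ.* m) (l ℕ.* n) ⟩
    [ l ℕ.* m ] + [ l ℕ.* n ]     ≡⟨ cong₂ _+_ ([]-* l m) ([]-* l n) ⟩
    [ l ] * [ m ] + [ l ] * [ n ] ∎

  +-comm : ∀ a b → a + b ≡ b + a
  +-comm a b = cong [_] (ℕ.+-comm (toℕ a) (toℕ b))

  *-comm : ∀ a b → a * b ≡ b * a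
  *-comm a b = cong [_] (ℕ.*-comm (toℕ a) (toℕ b))

  +-identityˡ : ∀ a → 0# + a ≡ a
  +-identityˡ = []-elim λ m → sym ([]-+ 0 m)

  +-identityʳ : ∀ a → a + 0# ≡ a
  +-identityʳ a = trans (+-comm a 0#) (+-identityˡ a)

  *-identityˡ : ∀ a → 1# * a ≡ a
  *-identityˡ = []-elim λ m → trans (sym ([]-* 1 m)) (cong [_] (ℕ.*-identityˡ m))

  -‿inverseˡ : ∀ a → - a + a ≡ 0#
  -‿inverseˡ a = begin
    - a + a                      ≡⟨ cong (- a +_) ([]-toℕ a) ⟨
    - a + [ toℕ a ]              ≡⟨ []-+ (p ℕ.∸ toℕ a) (toℕ a) ⟨
    [ p ℕ.∸ toℕ a ℕ.+ toℕ a ]    ≡⟨ cong [_] (ℕ.m∸n+n≡m (ℕ.<⇒≤ (toℕ<n a))) ⟩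
    [ p ]                        ≡⟨ %≡⇒[]≡ (trans (n%n≡0 p) (sym 0%p≡0)) ⟩
    0#                           ∎

  commutativeRing : CommutativeRing 0ℓ 0ℓ
  commutativeRing = record
    { _+_ = _+_ ; _*_ = _*_ ; -_ = -_ ; 0# = 0# ; 1# = 1#
    ; isCommutativeRing = record
      { isRing = record
        { +-isAbelianGroup = record
          { isGroup = record
            { isMonoid = record
              { isSemigroup = record
                { isMagma = record { isEquivalence = isEquivalence ; ∙-cong = cong₂ _+_ }
                ; assoc = +-assoc }
              ; identity = +-identityˡ , +-identityʳ }
            ; inverse = -‿inverseˡ , λ a → trans (+-comm a (- a)) (-‿inverseˡ a)
            ; ⁻¹-cong = cong -_ }
          ; comm = +-comm }
        ; *-cong = cong₂ _*_
        ; *-assoc = *-assoc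
        ; *-identity = *-identityˡ , λ a → trans (*-comm a 1#) (*-identityˡ a)
        ; distrib = *-distribˡ-+
                  , λ a b c → trans (*-comm (b + c) a) (trans (*-distribˡ-+ a b c) (cong₂ _+_ (*-comm a b) (*-comm a c))) }
      ; *-comm = *-comm } }

  open Algebra.Properties.Ring (CommutativeRing.ring commutativeRing) public
    using (-0#≈0#; -‿involutive; -‿+-comm; +-cancelʳ; -‿distribˡ-*; -‿distribʳ-*; x∙y⁻¹≈ε⇒x≈y)

  x+y≡z⇒x≡z-y : ∀ {x y z} → x + y ≡ z → x ≡ z + - y
  x+y≡z⇒x≡z-y {x} {y} {z} x+y≡z = +-cancelʳ y x (z + - y) (begin
    x + y           ≡⟨ x+y≡z ⟩
    z               ≡⟨ +-identityʳ z ⟨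
    z + 0#          ≡⟨ cong (z +_) (-‿inverseˡ y) ⟨
    z + (- y + y)   ≡⟨ +-assoc z (- y) y ⟨
    z + - y + y     ∎)

  -- The ring solver takes integer coefficients, mapped into F p by ι: normalising
  -- them computes, whereas arithmetic in F p is stuck on the variable p.
  ι : ℤ → F p
  ι (ℤ.+ n)  = [ n ]
  ι -[1+ n ] = - [ ℕ.suc n ]

  ι-neg : ∀ z → ι (ℤ.- z) ≡ - ι z
  ι-neg (ℤ.+ ℕ.zero)  = sym -0#≈0#
  ι-neg (ℤ.+ ℕ.suc n) = refl
  ι-neg -[1+ n ]      = sym (-‿involutive [ ℕ.suc n ])

  ι-⊖+[n] : ∀ m n → ι (m ⊖ n) + [ n ] ≡ [ m ]
  ι-⊖+[n] m n with m ℕ.<? n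
  ... | no m≮n = begin
    ι (m ⊖ n) + [ n ]        ≡⟨ cong (λ z → ι z + [ n ]) (ℤ.⊖-≥ (ℕ.≮⇒≥ m≮n)) ⟩
    [ m ℕ.∸ n ] + [ n ]      ≡⟨ []-+ (m ℕ.∸ n) n ⟨
    [ m ℕ.∸ n ℕ.+ n ]        ≡⟨ cong [_] (ℕ.m∸n+n≡m (ℕ.≮⇒≥ m≮n)) ⟩
    [ m ]                    ∎
  ... | yes m<n = begin
    ι (m ⊖ n) + [ n ]                  ≡⟨ cong (λ z → ι z + [ n ]) (ℤ.⊖-< m<n) ⟩
    ι (ℤ.- (ℤ.+ k)) + [ n ]            ≡⟨ cong (_+ [ n ]) (ι-neg (ℤ.+ k)) ⟩
    - [ k ] + [ n ]                    ≡⟨ cong (λ n → - [ k ] + [ n ]) (ℕ.m∸n+n≡m (ℕ.<⇒≤ m<n)) ⟨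
    - [ k ] + [ k ℕ.+ m ]              ≡⟨ cong (- [ k ] +_) ([]-+ k m) ⟩
    - [ k ] + ([ k ] + [ m ])          ≡⟨ +-assoc (- [ k ]) [ k ] [ m ] ⟨
    - [ k ] + [ k ] + [ m ]            ≡⟨ cong (_+ [ m ]) (-‿inverseˡ [ k ]) ⟩
    0# + [ m ]                         ≡⟨ +-identityˡ [ m ] ⟩
    [ m ]                              ∎
    where
    k : ℕ
    k = n ℕ.∸ m

  ι-+ : ∀ x y → ι (x ℤ.+ y) ≡ ι x + ι y
  ι-+ (ℤ.+ m)  (ℤ.+ n)  = []-+ m n
  ι-+ (ℤ.+ m)  -[1+ n ] = x+y≡z⇒x≡z-y (ι-⊖+[n] m (ℕ.suc n))
  ι-+ -[1+ m ] (ℤ.+ n)  = trans (x+y≡z⇒x≡z-y (ι-⊖+[n] n (ℕ.suc m))) (+-comm [ n ] (- [ ℕ.suc m ]))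
  ι-+ -[1+ m ] -[1+ n ] = begin
    - [ ℕ.suc (ℕ.suc (m ℕ.+ n)) ]   ≡⟨ cong (λ k → - [ k ]) (ℕ.+-suc (ℕ.suc m) n) ⟨
    - [ ℕ.suc m ℕ.+ ℕ.suc n ]       ≡⟨ cong -_ ([]-+ (ℕ.suc m) (ℕ.suc n)) ⟩
    - ([ ℕ.suc m ] + [ ℕ.suc n ])   ≡⟨ -‿+-comm [ ℕ.suc m ] [ ℕ.suc n ] ⟨
    - [ ℕ.suc m ] + - [ ℕ.suc n ]   ∎

  ι-+[m]* : ∀ m y → ι (ℤ.+ m ℤ.* y) ≡ [ m ] * ι y
  ι-+[m]* m (ℤ.+ n)  = trans (cong ι (sym (ℤ.pos-* m n))) ([]-* m n)
  ι-+[m]* m -[1+ n ] = begin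
    ι (ℤ.+ m ℤ.* ℤ.- ℤ.+ ℕ.suc n)     ≡⟨ cong ι (ℤ.neg-distribʳ-* (ℤ.+ m) (ℤ.+ ℕ.suc n)) ⟨
    ι (ℤ.- (ℤ.+ m ℤ.* ℤ.+ ℕ.suc n))   ≡⟨ ι-neg (ℤ.+ m ℤ.* ℤ.+ ℕ.suc n) ⟩
    - ι (ℤ.+ m ℤ.* ℤ.+ ℕ.suc n)       ≡⟨ cong -_ (ι-+[m]* m (ℤ.+ ℕ.suc n)) ⟩
    - ([ m ] * [ ℕ.suc n ])           ≡⟨ -‿distribʳ-* [ m ] [ ℕ.suc n ] ⟩
    [ m ] * - [ ℕ.suc n ]             ∎

  ι-* : ∀ x y → ι (x ℤ.* y) ≡ ι x * ι y
  ι-* (ℤ.+ m)  y = ι-+[m]* m y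
  ι-* -[1+ m ] y = begin
    ι (ℤ.- ℤ.+ ℕ.suc m ℤ.* y)     ≡⟨ cong ι (ℤ.neg-distribˡ-* (ℤ.+ ℕ.suc m) y) ⟨
    ι (ℤ.- (ℤ.+ ℕ.suc m ℤ.* y))   ≡⟨ ι-neg (ℤ.+ ℕ.suc m ℤ.* y) ⟩
    - ι (ℤ.+ ℕ.suc m ℤ.* y)       ≡⟨ cong -_ (ι-+[m]* (ℕ.suc m) y) ⟩
    - ([ ℕ.suc m ] * ι y)         ≡⟨ -‿distribˡ-* [ ℕ.suc m ] (ι y) ⟩
    - [ ℕ.suc m ] * ι y           ∎

  ι-homomorphism : ℤ.+-*-rawRing -Raw-AlmostCommutative⟶ fromCommutativeRing commutativeRing
  ι-homomorphism = record
    { ⟦_⟧ = ι ; +-homo = ι-+ ; *-homo = ι-* ; -‿homo = ι-neg ; 0-homo = refl ; 1-homo = refl }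

  ι-≟ : ∀ x y → Maybe (ι x ≡ ι y)
  ι-≟ x y = map (cong ι) (dec⇒maybe (x ℤ.≟ y))

  open Algebra.Solver.Ring ℤ.+-*-rawRing (fromCommutativeRing commutativeRing) ι-homomorphism ι-≟
    public using (solve; _:+_; _:*_; _:-_; :-_; con; _:=_)

module Plane (p : ℕ) .{{_ : NonZero p}} where

  open PrimeField p
  open ≡-Reasoning

  infixl 6 _+ᵥ_
  infixr 7 _·_
  infixl 7 _*ₘ_
  infixr 8 _$ₘ_

  V : Set
  V = V2 p

  _+ᵥ_ : V → V → V
  ⟨ a , b ⟩ +ᵥ ⟨ c , d ⟩ = ⟨ a + c , b + d ⟩

  _·_ : F p → V → V
  _·_ = _·V_ p

  0ᵥ : V
  0ᵥ = zeroV p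

  _*ₘ_ : Mat2 p → Mat2 p → Mat2 p
  _*ₘ_ = _*M_ p

  _$ₘ_ : Mat2 p → V → V
  _$ₘ_ = _$M_ p

  I : Mat2 p
  I = I2 p

  -I : Mat2 p
  -I = mat (- 1#) 0# 0# (- 1#)

  det : Mat2 p → F p
  det (mat a b c d) = a * d + - (b * c)

  +ᵥ-commutativeMonoid : CommutativeMonoid 0ℓ 0ℓ
  +ᵥ-commutativeMonoid = record
    { _≈_ = _≡_ ; _∙_ = _+ᵥ_ ; ε = 0ᵥ
    ; isCommutativeMonoid = record
      { isMonoid = record
        { isSemigroup = record
          { isMagma = record { isEquivalence = isEquivalence ; ∙-cong = cong₂ _+ᵥ_ }
          ; assoc = λ where ⟨ a , b ⟩ ⟨ c , d ⟩ ⟨ e , f ⟩ → cong₂ ⟨_,_⟩ (+-assoc a c e) (+-assoc b d f) }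
        ; identity = (λ where ⟨ a , b ⟩ → cong₂ ⟨_,_⟩ (+-identityˡ a) (+-identityˡ b))
                   , (λ where ⟨ a , b ⟩ → cong₂ ⟨_,_⟩ (+-identityʳ a) (+-identityʳ b)) }
      ; comm = λ where ⟨ a , b ⟩ ⟨ c , d ⟩ → cong₂ ⟨_,_⟩ (+-comm a c) (+-comm b d) } }

  open Algebra.Properties.CommutativeMonoid.Sum +ᵥ-commutativeMonoid public
    using (sum; sum-permute; sum-cong-≗)

  $ₘ-*ₘ : ∀ M N w → (M *ₘ N) $ₘ w ≡ M $ₘ N $ₘ w
  $ₘ-*ₘ (mat a b c d) (mat e f g h) ⟨ x , y ⟩ = cong₂ ⟨_,_⟩ (row a b) (row c d)
    where
    row : ∀ a b → (a * e + b * g) * x + (a * f + b * h) * y ≡ a * (e * x + f * y) + b * (g * x + h * y)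
    row a b = solve 8 (λ a b e f g h x y → (a :* e :+ b :* g) :* x :+ (a :* f :+ b :* h) :* y
                                         := a :* (e :* x :+ f :* y) :+ b :* (g :* x :+ h :* y)) refl a b e f g h x y

  $ₘ-+ᵥ : ∀ M u w → M $ₘ (u +ᵥ w) ≡ M $ₘ u +ᵥ M $ₘ w
  $ₘ-+ᵥ (mat a b c d) ⟨ x , y ⟩ ⟨ x′ , y′ ⟩ = cong₂ ⟨_,_⟩ (row a b) (row c d)
    where
    row : ∀ a b → a * (x + x′) + b * (y + y′) ≡ (a * x + b * y) + (a * x′ + b * y′)
    row a b = solve 6 (λ a b x y x′ y′ → a :* (x :+ x′) :+ b :* (y :+ y′)
                                       := (a :* x :+ b :* y) :+ (a :* x′ :+ b :* y′)) refl a b x y x′ y′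

  $ₘ-0ᵥ : ∀ M → M $ₘ 0ᵥ ≡ 0ᵥ
  $ₘ-0ᵥ (mat a b c d) = cong₂ ⟨_,_⟩ (row a b) (row c d)
    where
    row : ∀ a b → a * 0# + b * 0# ≡ 0#
    row a b = solve 2 (λ a b → a :* con 0ℤ :+ b :* con 0ℤ := con 0ℤ) refl a b

  $ₘ-· : ∀ M t w → M $ₘ (t · w) ≡ t · M $ₘ w
  $ₘ-· (mat a b c d) t ⟨ x , y ⟩ = cong₂ ⟨_,_⟩ (row a b) (row c d)
    where
    row : ∀ a b → a * (t * x) + b * (t * y) ≡ t * (a * x + b * y)
    row a b = solve 5 (λ a b t x y → a :* (t :* x) :+ b :* (t :* y) := t :* (a :* x :+ b :* y)) refl a b t x y

  $ₘ-sum : ∀ M {n} (f : Fin n → V) → M $ₘ sum f ≡ sum (λ k → M $ₘ f k)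
  $ₘ-sum M {ℕ.zero}  f = $ₘ-0ᵥ M
  $ₘ-sum M {ℕ.suc n} f = trans ($ₘ-+ᵥ M (f zero) (sum (f ∘ suc))) (cong (M $ₘ f zero +ᵥ_) ($ₘ-sum M (f ∘ suc)))

  I-$ₘ : ∀ w → I $ₘ w ≡ w
  I-$ₘ ⟨ x , y ⟩ = cong₂ ⟨_,_⟩ (solve 2 (λ x y → con 1ℤ :* x :+ con 0ℤ :* y := x) refl x y)
                                (solve 2 (λ x y → con 0ℤ :* x :+ con 1ℤ :* y := y) refl x y)

  -I-$ₘ : ∀ w → -I $ₘ w ≡ - 1# · w
  -I-$ₘ ⟨ x , y ⟩ = cong₂ ⟨_,_⟩ (solve 2 (λ x y → :- con 1ℤ :* x :+ con 0ℤ :* y := :- con 1ℤ :* x) refl x y)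
                                 (solve 2 (λ x y → con 0ℤ :* x :+ :- con 1ℤ :* y := :- con 1ℤ :* y) refl x y)

  ·-assoc : ∀ s t w → s · t · w ≡ (s * t) · w
  ·-assoc s t ⟨ x , y ⟩ = cong₂ ⟨_,_⟩ (sym (*-assoc s t x)) (sym (*-assoc s t y))

  ·-identityˡ : ∀ w → 1# · w ≡ w
  ·-identityˡ ⟨ x , y ⟩ = cong₂ ⟨_,_⟩ (*-identityˡ x) (*-identityˡ y)

  u+w≡0⇒w≡-u : ∀ u w → u +ᵥ w ≡ 0ᵥ → w ≡ - 1# · u
  u+w≡0⇒w≡-u ⟨ a , b ⟩ ⟨ c , d ⟩ u+w≡0 =
    cong₂ ⟨_,_⟩ (coordinate a c (cong V2.x u+w≡0)) (coordinate b d (cong V2.y u+w≡0))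
    where
    coordinate : ∀ a c → a + c ≡ 0# → c ≡ - 1# * a
    coordinate a c a+c≡0 = begin
      c                    ≡⟨ solve 2 (λ a c → c := :- con 1ℤ :* a :+ (a :+ c)) refl a c ⟩
      - 1# * a + (a + c)   ≡⟨ cong (- 1# * a +_) a+c≡0 ⟩
      - 1# * a + 0#        ≡⟨ +-identityʳ (- 1# * a) ⟩
      - 1# * a             ∎

  det-*ₘ : ∀ M N → det (M *ₘ N) ≡ det M * det N
  det-*ₘ (mat a b c d) (mat e f g h) = solve 8 (λ a b c d e f g h →
    (a :* e :+ b :* g) :* (c :* f :+ d :* h) :- (a :* f :+ b :* h) :* (c :* e :+ d :* g)
    := (a :* d :- b :* c) :* (e :* h :- f :* g)) refl a b c d e f g h

  det-I : det I ≡ 1#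
  det-I = solve 0 (con 1ℤ :* con 1ℤ :- con 0ℤ :* con 0ℤ := con 1ℤ) refl

module OddPrimeField (p : ℕ) .{{_ : NonZero p}} (p-prime : Prime p) (2<p : 2 < p) where

  open PrimeField p public
  open Plane p using (_·_; 0ᵥ; I; -I; _*ₘ_; det; det-*ₘ; det-I)
  open ≡-Reasoning
  open CommutativeRing commutativeRing using (semiring; commutativeSemiring; +-rawMonoid; +-monoid)
  open Algebra.Properties.Semiring.Exp semiring using (_^_; ^-homo-*; ^-assocʳ)
  open Algebra.Properties.CommutativeSemiring.Binomial commutativeSemiring using (theorem; binomialTerm)
  open Algebra.Properties.Monoid.Sum +-monoid using (sum; sum-init-last; sum-cong-≗; sum-replicate-zero)
  open Algebra.Definitions.RawMonoid +-rawMonoid using () renaming (_×_ to _×′_)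

  p∣n⇒[n]≡0# : ∀ {n} → p ∣ n → [ n ] ≡ 0#
  p∣n⇒[n]≡0# {n} p∣n = %≡⇒[]≡ (trans (n∣m⇒m%n≡0 n p p∣n) (sym 0%p≡0))

  [n]≡0#⇒p∣n : ∀ {n} → [ n ] ≡ 0# → p ∣ n
  [n]≡0#⇒p∣n {n} [n]≡0 = m%n≡0⇒n∣m n p (trans ([]≡⇒%≡ [n]≡0) 0%p≡0)

  [n]≢0# : ∀ {n} → 0 < n → n < p → [ n ] ≢ 0#
  [n]≢0# 0<n n<p [n]≡0 = >⇒∤ {{ℕ.>-nonZero 0<n}} n<p ([n]≡0#⇒p∣n [n]≡0)

  1#≢0# : 1# ≢ 0#
  1#≢0# = [n]≢0# ℕ.z<s (ℕ.<-trans (ℕ.n<1+n 1) 2<p)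

  2#≢0# : 1# + 1# ≢ 0#
  2#≢0# 2≡0 = [n]≢0# ℕ.z<s 2<p (trans ([]-+ 1 1) 2≡0)

  x*y≡0⇒x≡0∨y≡0 : ∀ x y → x * y ≡ 0# → x ≡ 0# ⊎ y ≡ 0#
  x*y≡0⇒x≡0∨y≡0 x y xy≡0 with euclidsLemma (toℕ x) (toℕ y) p-prime ([n]≡0#⇒p∣n xy≡0)
  ... | inj₁ p∣x = inj₁ (trans (sym ([]-toℕ x)) (p∣n⇒[n]≡0# p∣x))
  ... | inj₂ p∣y = inj₂ (trans (sym ([]-toℕ y)) (p∣n⇒[n]≡0# p∣y))

  x-y≡0⇒x≡y : ∀ {x y} → x + - y ≡ 0# → x ≡ y
  x-y≡0⇒x≡y = x∙y⁻¹≈ε⇒x≈y _ _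

  x+x≡0⇒x≡0 : ∀ {x} → x + x ≡ 0# → x ≡ 0#
  x+x≡0⇒x≡0 {x} x+x≡0 = [ (λ 2≡0 → ⊥-elim (2#≢0# 2≡0)) , (λ x≡0 → x≡0) ]′
    (x*y≡0⇒x≡0∨y≡0 (1# + 1#) x (trans (solve 1 (λ x → (con 1ℤ :+ con 1ℤ) :* x := x :+ x) refl x) x+x≡0))

  *-cancelˡ : ∀ {c} x y → c ≢ 0# → c * x ≡ c * y → x ≡ y
  *-cancelˡ {c} x y c≢0 cx≡cy = [ (λ c≡0 → ⊥-elim (c≢0 c≡0)) , x-y≡0⇒x≡y ]′
    (x*y≡0⇒x≡0∨y≡0 c (x + - y) (begin
      c * (x + - y)       ≡⟨ solve 3 (λ c x y → c :* (x :- y) := c :* x :- c :* y) refl c x y ⟩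
      c * x + - (c * y)   ≡⟨ cong (λ z → z + - (c * y)) cx≡cy ⟩
      c * y + - (c * y)   ≡⟨ solve 1 (λ z → z :- z := con 0ℤ) refl (c * y) ⟩
      0#                  ∎))

  x*x≡1⇒x≡±1 : ∀ {x} → x * x ≡ 1# → x ≡ 1# ⊎ x ≡ - 1#
  x*x≡1⇒x≡±1 {x} x²≡1 = [ (λ x-1≡0 → inj₁ (x-y≡0⇒x≡y x-1≡0))
                         , (λ x+1≡0 → inj₂ (x-y≡0⇒x≡y (trans (cong (x +_) (-‿involutive 1#)) x+1≡0))) ]′
    (x*y≡0⇒x≡0∨y≡0 (x + - 1#) (x + 1#) (begin
      (x + - 1#) * (x + 1#)   ≡⟨ solve 1 (λ x → (x :- con 1ℤ) :* (x :+ con 1ℤ) := x :* x :- con 1ℤ) refl x ⟩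
      x * x + - 1#            ≡⟨ cong (_+ - 1#) x²≡1 ⟩
      1# + - 1#               ≡⟨ solve 0 (con 1ℤ :- con 1ℤ := con 0ℤ) refl ⟩
      0#                      ∎))

  n×′x≡[n]*x : ∀ n x → n ×′ x ≡ [ n ] * x
  n×′x≡[n]*x ℕ.zero    x = solve 1 (λ x → con 0ℤ := con 0ℤ :* x) refl x
  n×′x≡[n]*x (ℕ.suc n) x = begin
    x + n ×′ x         ≡⟨ cong (x +_) (n×′x≡[n]*x n x) ⟩
    x + [ n ] * x      ≡⟨ solve 2 (λ x m → x :+ m :* x := (con 1ℤ :+ m) :* x) refl x [ n ] ⟩
    (1# + [ n ]) * x   ≡⟨ cong (_* x) ([]-+ 1 n) ⟨
    [ ℕ.suc n ] * x    ∎

  1#^n≡1# : ∀ n → 1# ^ n ≡ 1#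
  1#^n≡1# ℕ.zero    = refl
  1#^n≡1# (ℕ.suc n) = trans (cong (1# *_) (1#^n≡1# n)) (*-identityˡ 1#)

  0#^n≡0# : ∀ n .{{_ : NonZero n}} → 0# ^ n ≡ 0#
  0#^n≡0# (ℕ.suc n) = solve 1 (λ z → con 0ℤ :* z := con 0ℤ) refl (0# ^ n)

  binomial-without-middle : ∀ n .{{_ : NonZero n}} x y → (∀ k → 0 < k → k < n → [ n C k ] ≡ 0#) →
                            (x + y) ^ n ≡ x ^ n + y ^ n
  binomial-without-middle n@(ℕ.suc m) x y middle≡0 = begin
    (x + y) ^ n
      ≡⟨ theorem n x y ⟩
    t zero + sum (t ∘ suc)
      ≡⟨ cong (t zero +_) (sum-init-last (t ∘ suc)) ⟩
    t zero + (sum (t ∘ suc ∘ inject₁) + t (fromℕ n))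
      ≡⟨ cong₂ (λ a b → t zero + (a + b)) middle-sum≡0 last≡xⁿ ⟩
    t zero + (0# + x ^ n)
      ≡⟨ solve 2 (λ a b → con 1ℤ :* a :+ con 0ℤ :+ (con 0ℤ :+ b) := b :+ a) refl (y ^ n) (x ^ n) ⟩
    x ^ n + y ^ n ∎
    where
    t : Fin (ℕ.suc n) → F p
    t = binomialTerm x y n
    middle-sum≡0 : sum (t ∘ suc ∘ inject₁) ≡ 0#
    middle-sum≡0 = trans (sum-cong-≗ middle-term≡0) (sum-replicate-zero m)
      where
      middle-term≡0 : ∀ k → t (suc (inject₁ k)) ≡ 0#
      middle-term≡0 k = begin
        (n C k′) ×′ z     ≡⟨ n×′x≡[n]*x (n C k′) z ⟩
        [ n C k′ ] * z    ≡⟨ cong (_* z) (middle≡0 k′ ℕ.z<s (ℕ.s<s k<m)) ⟩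
        0# * z            ≡⟨ solve 1 (λ z → con 0ℤ :* z := con 0ℤ) refl z ⟩
        0#                ∎
        where
        k′ : ℕ
        k′ = ℕ.suc (toℕ (inject₁ k))
        z : F p
        z = x ^ k′ * y ^ (n ℕ.∸ k′)
        k<m : toℕ (inject₁ k) < m
        k<m = subst (_< m) (sym (toℕ-inject₁ k)) (toℕ<n k)
    last≡xⁿ : t (fromℕ n) ≡ x ^ n
    last≡xⁿ = begin
      (n C toℕ (fromℕ n)) ×′ (x ^ toℕ (fromℕ n) * y ^ (n ℕ.∸ toℕ (fromℕ n)))
        ≡⟨ cong (λ k → (n C k) ×′ (x ^ k * y ^ (n ℕ.∸ k))) (toℕ-fromℕ n) ⟩
      (n C n) ×′ (x ^ n * y ^ (n ℕ.∸ n))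
        ≡⟨ cong₂ (λ c e → c ×′ (x ^ n * y ^ e)) (nCn≡1 n) (ℕ.n∸n≡0 n) ⟩
      x ^ n * 1# + 0#
        ≡⟨ solve 1 (λ a → a :* con 1ℤ :+ con 0ℤ := a) refl (x ^ n) ⟩
      x ^ n ∎

  freshman's-dream : ∀ x y → (x + y) ^ p ≡ x ^ p + y ^ p
  freshman's-dream x y = binomial-without-middle p x y λ k 0<k k<p → p∣n⇒[n]≡0# (p∣pCk p-prime 0<k k<p)

  fermat : ∀ x → x ^ p ≡ x
  fermat = []-elim [n]^p≡[n]
    where
    [n]^p≡[n] : ∀ n → [ n ] ^ p ≡ [ n ]
    [n]^p≡[n] ℕ.zero    = 0#^n≡0# p
    [n]^p≡[n] (ℕ.suc n) = begin
      [ ℕ.suc n ] ^ p      ≡⟨ cong (_^ p) [1+n]≡[n]+1 ⟩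
      ([ n ] + 1#) ^ p     ≡⟨ freshman's-dream [ n ] 1# ⟩
      [ n ] ^ p + 1# ^ p   ≡⟨ cong₂ _+_ ([n]^p≡[n] n) (1#^n≡1# p) ⟩
      [ n ] + 1#           ≡⟨ [1+n]≡[n]+1 ⟨
      [ ℕ.suc n ]          ∎
      where
      [1+n]≡[n]+1 : [ ℕ.suc n ] ≡ [ n ] + 1#
      [1+n]≡[n]+1 = trans (cong [_] (ℕ.+-comm 1 n)) ([]-+ n 1)

  square≡-1⇒p%4≡1 : ∀ d → d * d ≡ - 1# → p % 4 ≡ 1
  square≡-1⇒p%4≡1 d d²≡-1 =
    [ (λ p%4≡1 → p%4≡1) , (λ p%4≡3 → ⊥-elim (1#≢0# (p%4≡3⇒1≡0 p%4≡3))) ]′ (prime>2⇒p%4≡1∨3 p-prime 2<p)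
    where
    d^p≡-d : p % 4 ≡ 3 → d ^ p ≡ - d
    d^p≡-d p%4≡3 = begin
      d ^ p                    ≡⟨ cong (d ^_) (trans (m≡m%n+[m/n]*n p 4) (cong (ℕ._+ q ℕ.* 4) p%4≡3)) ⟩
      d ^ (3 ℕ.+ q ℕ.* 4)      ≡⟨ ^-homo-* d 3 (q ℕ.* 4) ⟩
      d ^ 3 * d ^ (q ℕ.* 4)    ≡⟨ cong (λ e → d ^ 3 * d ^ e) (ℕ.*-comm q 4) ⟩
      d ^ 3 * d ^ (4 ℕ.* q)    ≡⟨ cong (d ^ 3 *_) (^-assocʳ d 4 q) ⟨
      d ^ 3 * (d ^ 4) ^ q      ≡⟨ cong (λ z → d ^ 3 * z ^ q) d⁴≡1 ⟩
      d ^ 3 * 1# ^ q           ≡⟨ cong (d ^ 3 *_) (1#^n≡1# q) ⟩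
      d ^ 3 * 1#               ≡⟨ solve 1 (λ d → d :* (d :* (d :* con 1ℤ)) :* con 1ℤ := d :* (d :* d)) refl d ⟩
      d * (d * d)              ≡⟨ cong (d *_) d²≡-1 ⟩
      d * - 1#                 ≡⟨ solve 1 (λ d → d :* :- con 1ℤ := :- d) refl d ⟩
      - d                      ∎
      where
      q : ℕ
      q = p ℕ./ 4
      d⁴≡1 : d ^ 4 ≡ 1#
      d⁴≡1 = begin
        d ^ 4               ≡⟨ solve 1 (λ d → d :* (d :* (d :* (d :* con 1ℤ))) := (d :* d) :* (d :* d)) refl d ⟩
        (d * d) * (d * d)   ≡⟨ cong₂ _*_ d²≡-1 d²≡-1 ⟩
        - 1# * - 1#         ≡⟨ solve 0 (:- con 1ℤ :* :- con 1ℤ := con 1ℤ) refl ⟩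
        1#                  ∎
    p%4≡3⇒1≡0 : p % 4 ≡ 3 → 1# ≡ 0#
    p%4≡3⇒1≡0 p%4≡3 = begin
      1#            ≡⟨ -‿involutive 1# ⟨
      - - 1#        ≡⟨ cong -_ d²≡-1 ⟨
      - (d * d)     ≡⟨ cong (λ z → - (z * z)) d≡0 ⟩
      - (0# * 0#)   ≡⟨ solve 0 (:- (con 0ℤ :* con 0ℤ) := con 0ℤ) refl ⟩
      0#            ∎
      where
      d≡0 : d ≡ 0#
      d≡0 = x+x≡0⇒x≡0 (begin
        d + d     ≡⟨ cong (d +_) (trans (sym (fermat d)) (d^p≡-d p%4≡3)) ⟩
        d + - d   ≡⟨ solve 1 (λ d → d :- d := con 0ℤ) refl d ⟩
        0#        ∎)

  w≡-w⇒w≡0 : ∀ w → w ≡ - 1# · w → w ≡ 0ᵥ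
  w≡-w⇒w≡0 ⟨ x , y ⟩ w≡-w = cong₂ ⟨_,_⟩ (coordinate x (cong V2.x w≡-w)) (coordinate y (cong V2.y w≡-w))
    where
    coordinate : ∀ x → x ≡ - 1# * x → x ≡ 0#
    coordinate x x≡-x = x+x≡0⇒x≡0 (begin
      x + x          ≡⟨ cong (x +_) x≡-x ⟩
      x + - 1# * x   ≡⟨ solve 1 (λ x → x :+ :- con 1ℤ :* x := con 0ℤ) refl x ⟩
      0#             ∎)

  det-involution≡±1 : ∀ X → X *ₘ X ≡ I → det X ≡ 1# ⊎ det X ≡ - 1#
  det-involution≡±1 X X²≡I = x*x≡1⇒x≡±1 (trans (sym (det-*ₘ X X)) (trans (cong det X²≡I) det-I))

  involution-det1≡±I : ∀ X → X *ₘ X ≡ I → det X ≡ 1# → X ≡ I ⊎ X ≡ -I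
  involution-det1≡±I (mat a b c d) X²≡I detX≡1 =
    [ (λ a≡1 → inj₁ (cong₄ a≡1 b≡0 c≡0 (trans (sym a≡d) a≡1)))
    , (λ a≡-1 → inj₂ (cong₄ a≡-1 b≡0 c≡0 (trans (sym a≡d) a≡-1))) ]′ (x*x≡1⇒x≡±1 a²≡1)
    where
    cong₄ : ∀ {a b c d a′ b′ c′ d′} → a ≡ a′ → b ≡ b′ → c ≡ c′ → d ≡ d′ → mat a b c d ≡ mat a′ b′ c′ d′
    cong₄ refl refl refl refl = refl
    t : F p
    t = a + d
    t*b≡0 : t * b ≡ 0#
    t*b≡0 = trans (solve 4 (λ a b c d → (a :+ d) :* b := a :* b :+ b :* d) refl a b c d) (cong Mat2.b X²≡I)
    t*c≡0 : t * c ≡ 0#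
    t*c≡0 = trans (solve 4 (λ a b c d → (a :+ d) :* c := c :* a :+ d :* c) refl a b c d) (cong Mat2.c X²≡I)
    t*a≡2 : t * a ≡ 1# + 1#
    t*a≡2 = trans (solve 4 (λ a b c d → (a :+ d) :* a := (a :* a :+ b :* c) :+ (a :* d :- b :* c)) refl a b c d)
                  (cong₂ _+_ (cong Mat2.a X²≡I) detX≡1)
    t*d≡2 : t * d ≡ 1# + 1#
    t*d≡2 = trans (solve 4 (λ a b c d → (a :+ d) :* d := (c :* b :+ d :* d) :+ (a :* d :- b :* c)) refl a b c d)
                  (cong₂ _+_ (cong Mat2.d X²≡I) detX≡1)
    t≢0 : t ≢ 0#
    t≢0 t≡0 = 2#≢0# (begin
      1# + 1#   ≡⟨ t*a≡2 ⟨
      t * a     ≡⟨ cong (_* a) t≡0 ⟩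
      0# * a    ≡⟨ solve 1 (λ a → con 0ℤ :* a := con 0ℤ) refl a ⟩
      0#        ∎)
    t*x≡0⇒x≡0 : ∀ {x} → t * x ≡ 0# → x ≡ 0#
    t*x≡0⇒x≡0 {x} = [ (λ t≡0 → ⊥-elim (t≢0 t≡0)) , (λ x≡0 → x≡0) ]′ ∘ x*y≡0⇒x≡0∨y≡0 t x
    b≡0 : b ≡ 0#
    b≡0 = t*x≡0⇒x≡0 t*b≡0
    c≡0 : c ≡ 0#
    c≡0 = t*x≡0⇒x≡0 t*c≡0
    a≡d : a ≡ d
    a≡d = *-cancelˡ a d t≢0 (trans t*a≡2 (sym t*d≡2))
    a²≡1 : a * a ≡ 1#
    a²≡1 = begin
      a * a            ≡⟨ solve 2 (λ a c → a :* a := a :* a :+ con 0ℤ :* c) refl a c ⟩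
      a * a + 0# * c   ≡⟨ cong (λ z → a * a + z * c) b≡0 ⟨
      a * a + b * c    ≡⟨ cong Mat2.a X²≡I ⟩
      1#               ∎

-- The symmetric group 𝔖₄

_≟ₚ_ : DecidableEquality Perm4
_≟ₚ_ = ≡-dec Fin._≟_

open import Data.List.Membership.DecPropositional _≟ₚ_ using (_∈_; _∈?_)

lookup-∘ₚ : ∀ σ τ k → lookup (σ ∘ₚ τ) k ≡ lookup σ (lookup τ k)
lookup-∘ₚ σ τ k = lookup-map k (lookup σ) τ

∘ₚ-assoc : ∀ σ τ υ → (σ ∘ₚ τ) ∘ₚ υ ≡ σ ∘ₚ (τ ∘ₚ υ)
∘ₚ-assoc σ τ υ = trans (map-cong (lookup-∘ₚ σ τ) υ) (map-∘ (lookup σ) (lookup τ) υ)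

∘ₚ-identityˡ : ∀ σ → idₚ ∘ₚ σ ≡ σ
∘ₚ-identityˡ σ = trans (map-cong lookup-allFin σ) (map-id σ)

bijection⇒permutation : ∀ {σ} → IsBijection σ → Permutation′ 4
bijection⇒permutation {σ} bij = permutation (lookup σ) (λ j → proj₁ (bij j))
  (λ j → proj₁ (proj₂ (bij j))) (λ i → sym (proj₂ (proj₂ (bij (lookup σ i))) i refl))

S₄ : List Perm4
S₄ =
  (0F ∷ 1F ∷ 2F ∷ 3F ∷ []) ∷ (0F ∷ 1F ∷ 3F ∷ 2F ∷ []) ∷ (0F ∷ 2F ∷ 1F ∷ 3F ∷ []) ∷
  (0F ∷ 2F ∷ 3F ∷ 1F ∷ []) ∷ (0F ∷ 3F ∷ 1F ∷ 2F ∷ []) ∷ (0F ∷ 3F ∷ 2F ∷ 1F ∷ []) ∷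
  (1F ∷ 0F ∷ 2F ∷ 3F ∷ []) ∷ (1F ∷ 0F ∷ 3F ∷ 2F ∷ []) ∷ (1F ∷ 2F ∷ 0F ∷ 3F ∷ []) ∷
  (1F ∷ 2F ∷ 3F ∷ 0F ∷ []) ∷ (1F ∷ 3F ∷ 0F ∷ 2F ∷ []) ∷ (1F ∷ 3F ∷ 2F ∷ 0F ∷ []) ∷
  (2F ∷ 0F ∷ 1F ∷ 3F ∷ []) ∷ (2F ∷ 0F ∷ 3F ∷ 1F ∷ []) ∷ (2F ∷ 1F ∷ 0F ∷ 3F ∷ []) ∷
  (2F ∷ 1F ∷ 3F ∷ 0F ∷ []) ∷ (2F ∷ 3F ∷ 0F ∷ 1F ∷ []) ∷ (2F ∷ 3F ∷ 1F ∷ 0F ∷ []) ∷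
  (3F ∷ 0F ∷ 1F ∷ 2F ∷ []) ∷ (3F ∷ 0F ∷ 2F ∷ 1F ∷ []) ∷ (3F ∷ 1F ∷ 0F ∷ 2F ∷ []) ∷
  (3F ∷ 1F ∷ 2F ∷ 0F ∷ []) ∷ (3F ∷ 2F ∷ 0F ∷ 1F ∷ []) ∷ (3F ∷ 2F ∷ 1F ∷ 0F ∷ []) ∷ []

Surjective : Perm4 → Set
Surjective σ = ∀ j → ∃[ i ] lookup σ i ≡ j

abstract
  surjective⇒∈S₄ : ∀ x₀ x₁ x₂ x₃ → Surjective (x₀ ∷ x₁ ∷ x₂ ∷ x₃ ∷ [])
                                  → (x₀ ∷ x₁ ∷ x₂ ∷ x₃ ∷ []) ∈ S₄
  surjective⇒∈S₄ = from-yes (all? λ x₀ → all? λ x₁ → all? λ x₂ → all? λ x₃ →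
    (all? λ j → any? λ i → lookup (x₀ ∷ x₁ ∷ x₂ ∷ x₃ ∷ []) i Fin.≟ j) →-dec ((x₀ ∷ x₁ ∷ x₂ ∷ x₃ ∷ []) ∈? S₄))

bijection⇒∈S₄ : ∀ {σ} → IsBijection σ → σ ∈ S₄
bijection⇒∈S₄ {x₀ ∷ x₁ ∷ x₂ ∷ x₃ ∷ []} bij =
  surjective⇒∈S₄ x₀ x₁ x₂ x₃ λ j → proj₁ (bij j) , proj₁ (proj₂ (bij j))

-- Reading Fin 4 as 𝔽₂², the Klein four-group V₄ consists of the translations
-- klein k : x ↦ x ⊕ k.
klein : Fin 4 → Perm4
klein 0F = idₚ
klein 1F = 1F ∷ 0F ∷ 3F ∷ 2F ∷ []
klein 2F = 2F ∷ 3F ∷ 0F ∷ 1F ∷ []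
klein 3F = 3F ∷ 2F ∷ 1F ∷ 0F ∷ []

_⊕_ : Fin 4 → Fin 4 → Fin 4
x ⊕ k = lookup (klein k) x

abstract
  ⊕-cancelˡ : ∀ i j → i ⊕ (i ⊕ j) ≡ j
  ⊕-cancelˡ = from-yes (all? λ i → all? λ j → i ⊕ (i ⊕ j) Fin.≟ j)

  ⊕-swap : ∀ i j → j ⊕ (i ⊕ j) ≡ i
  ⊕-swap = from-yes (all? λ i → all? λ j → j ⊕ (i ⊕ j) Fin.≟ i)

  klein-involutive : ∀ k → klein k ∘ₚ klein k ≡ idₚ
  klein-involutive = from-yes (all? λ k → (klein k ∘ₚ klein k) ≟ₚ idₚ)

  klein-∘ : ∀ k b → klein k ∘ₚ klein b ≡ klein (b ⊕ k)
  klein-∘ = from-yes (all? λ k → all? λ b → (klein k ∘ₚ klein b) ≟ₚ klein (b ⊕ k))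

translation : Fin 4 → Permutation′ 4
translation i = permutation (i ⊕_) (i ⊕_) (⊕-cancelˡ i) (⊕-cancelˡ i)

fourCycles : List Perm4
fourCycles = (1F ∷ 2F ∷ 3F ∷ 0F ∷ []) ∷ (1F ∷ 3F ∷ 0F ∷ 2F ∷ []) ∷ (2F ∷ 3F ∷ 1F ∷ 0F ∷ []) ∷ []

power : Perm4 → Fin 4 → Perm4
power g 0F = idₚ
power g 1F = g
power g 2F = g ∘ₚ g
power g 3F = g ∘ₚ (g ∘ₚ g)

InPowers : Perm4 → Perm4 → Set
InPowers g σ = ∃[ k ] power g k ≡ σ

inPowers? : ∀ g σ → Dec (InPowers g σ)
inPowers? g σ = any? λ k → power g k ≟ₚ σ

abstract
  power-injective : All (λ g → ∀ a b → power g a ≡ power g b → a ≡ b) fourCycles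
  power-injective = from-yes (All.all? (λ g → all? λ a → all? λ b →
    (power g a ≟ₚ power g b) →-dec (a Fin.≟ b)) fourCycles)

  power-+₄ : All (λ g → ∀ a b → power g (a +₄ b) ≡ power g a ∘ₚ power g b) fourCycles
  power-+₄ = from-yes (All.all? (λ g → all? λ a → all? λ b →
    power g (a +₄ b) ≟ₚ (power g a ∘ₚ power g b)) fourCycles)

  power-fixing-a-point≡idₚ : All (λ g → ∀ i k → lookup (power g k) i ≡ i → power g k ≡ idₚ) fourCycles
  power-fixing-a-point≡idₚ = from-yes (All.all? (λ g → all? λ i → all? λ k →
    (lookup (power g k) i Fin.≟ i) →-dec (power g k ≟ₚ idₚ)) fourCycles)

products : List Perm4 → List Perm4
products l = l ++ cartesianProductWith _∘ₚ_ l l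

-- Products of at most four of the given permutations; by the checks below, this
-- is as much of the generated subgroup as is needed.
generated : List Perm4 → List Perm4
generated l = products (products l)

ContainsKlein : List Perm4 → Set
ContainsKlein l = ∀ k → klein k ∈ l

containsKlein? : ∀ l → Dec (ContainsKlein l)
containsKlein? l = all? λ k → klein k ∈? l

sends? : (i j : Fin 4) (σ : Perm4) → Dec (lookup σ i ≡ j)
sends? i j σ = lookup σ i Fin.≟ j

sending : Fin 4 → Fin 4 → List Perm4
sending i j = filter (sends? i j) S₄

abstract
  transitive-generators : All (λ s₁ → All (λ s₂ → All (λ s₃ →
      ContainsKlein (generated (s₁ ∷ s₂ ∷ s₃ ∷ [])) ⊎ Any (_∈ generated (s₁ ∷ s₂ ∷ s₃ ∷ [])) fourCycles)
    (sending 0F 3F)) (sending 0F 2F)) (sending 0F 1F)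
  transitive-generators = from-yes (All.all? (λ s₁ → All.all? (λ s₂ → All.all? (λ s₃ →
      containsKlein? (generated (s₁ ∷ s₂ ∷ s₃ ∷ []))
      ⊎-dec Any.any? (_∈? generated (s₁ ∷ s₂ ∷ s₃ ∷ [])) fourCycles)
    (sending 0F 3F)) (sending 0F 2F)) (sending 0F 1F))

  outside-powers⇒klein : All (λ g → All (λ π →
      InPowers g π ⊎ ContainsKlein (generated (π ∷ g ∷ (g ∘ₚ g) ∷ []))) S₄) fourCycles
  outside-powers⇒klein = from-yes (All.all? (λ g → All.all? (λ π →
    inPowers? g π ⊎-dec containsKlein? (generated (π ∷ g ∷ (g ∘ₚ g) ∷ []))) S₄) fourCycles)

KleinSubgroup⊆ : (Perm4 → Bool) → Set
KleinSubgroup⊆ G = ∀ k → G (klein k) ≡ true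

GeneratedByFourCycle : (Perm4 → Bool) → Set
GeneratedByFourCycle G = ∃[ g ] (g ∈ fourCycles × G g ≡ true × ∀ σ → G σ ≡ true → InPowers g σ)

module Subgroup {G : Perm4 → Bool} (G-subgroup : IsSubgroupS4 G) where

  open IsSubgroupS4 G-subgroup

  AllIn : List Perm4 → Set
  AllIn = All (λ σ → G σ ≡ true)

  products-⊆ : ∀ {l} → AllIn l → AllIn (products l)
  products-⊆ {l} l⊆G = All.++⁺ l⊆G (All.cartesianProductWith⁺ (setoid Perm4) (setoid Perm4) _∘ₚ_ l l
    λ σ∈l τ∈l → closed-∘ _ _ (All.lookup l⊆G σ∈l) (All.lookup l⊆G τ∈l))

  generated-⊆ : ∀ {l} → AllIn l → AllIn (generated l)
  generated-⊆ = products-⊆ ∘ products-⊆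

  power-∈ : ∀ {g} → G g ≡ true → ∀ k → G (power g k) ≡ true
  power-∈ Gg 0F = has-id
  power-∈ Gg 1F = Gg
  power-∈ Gg 2F = closed-∘ _ _ Gg Gg
  power-∈ Gg 3F = closed-∘ _ _ Gg (closed-∘ _ _ Gg Gg)

  transitive⇒klein⊆⊎fourCycle : IsTransitive G → KleinSubgroup⊆ G ⊎ GeneratedByFourCycle G
  transitive⇒klein⊆⊎fourCycle transitive with all? (λ k → G (klein k) Bool.≟ true)
  ... | yes klein⊆G = inj₁ klein⊆G
  ... | no  klein⊈G = inj₂ (fourCycle-generates (All.lookup (All.lookup (All.lookup transitive-generators
          (∈sending s₁)) (∈sending s₂)) (∈sending s₃)))
    where
    s₁ : ∃[ σ ] (G σ ≡ true × lookup σ 0F ≡ 1F)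
    s₁ = transitive 0F 1F
    s₂ : ∃[ σ ] (G σ ≡ true × lookup σ 0F ≡ 2F)
    s₂ = transitive 0F 2F
    s₃ : ∃[ σ ] (G σ ≡ true × lookup σ 0F ≡ 3F)
    s₃ = transitive 0F 3F
    gens : List Perm4
    gens = proj₁ s₁ ∷ proj₁ s₂ ∷ proj₁ s₃ ∷ []
    gens⊆G : AllIn gens
    gens⊆G = proj₁ (proj₂ s₁) ∷ proj₁ (proj₂ s₂) ∷ proj₁ (proj₂ s₃) ∷ []
    ∈sending : ∀ {j} (s : ∃[ σ ] (G σ ≡ true × lookup σ 0F ≡ j)) → proj₁ s ∈ sending 0F j
    ∈sending {j} (σ , Gσ , σ0≡j) = ∈-filter⁺ (sends? 0F j) (bijection⇒∈S₄ (members-bij σ Gσ)) σ0≡j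
    ¬containsKlein : ∀ {l} → AllIn l → ¬ ContainsKlein (generated l)
    ¬containsKlein l⊆G klein∈ = klein⊈G λ k → All.lookup (generated-⊆ l⊆G) (klein∈ k)
    fourCycle-generates : ContainsKlein (generated gens) ⊎ Any (_∈ generated gens) fourCycles → GeneratedByFourCycle G
    fourCycle-generates (inj₁ klein∈) = ⊥-elim (¬containsKlein gens⊆G klein∈)
    fourCycle-generates (inj₂ cycle∈) with find cycle∈
    ... | g , g∈cycles , g∈gens = g , g∈cycles , Gg , G⊆⟨g⟩
      where
      Gg : G g ≡ true
      Gg = All.lookup (generated-⊆ gens⊆G) g∈gens
      G⊆⟨g⟩ : ∀ σ → G σ ≡ true → InPowers g σ
      G⊆⟨g⟩ σ Gσ =
        [ (λ σ∈⟨g⟩ → σ∈⟨g⟩) , (λ klein∈ → ⊥-elim (¬containsKlein (Gσ ∷ Gg ∷ closed-∘ g g Gg Gg ∷ []) klein∈)) ]′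
        (All.lookup (All.lookup outside-powers⇒klein g∈cycles) (bijection⇒∈S₄ (members-bij σ Gσ)))

  fourCycle⇒IsoToC4 : GeneratedByFourCycle G → IsoToC4 G
  fourCycle⇒IsoToC4 (g , g∈cycles , Gg , G⊆⟨g⟩) =
    power g , power-∈ Gg , All.lookup power-injective g∈cycles , G⊆⟨g⟩ , All.lookup power-+₄ g∈cycles

  fourCycle⇒stabilizer-trivial : GeneratedByFourCycle G → ∀ i σ → InPointStab G i σ → σ ≡ idₚ
  fourCycle⇒stabilizer-trivial (g , g∈cycles , Gg , G⊆⟨g⟩) i σ (Gσ , σi≡i) with G⊆⟨g⟩ σ Gσ
  ... | k , refl = All.lookup power-fixing-a-point≡idₚ g∈cycles i k σi≡i

module Representation (p : ℕ) .{{_ : NonZero p}} (p-prime : Prime p) (2<p : 2 < p)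
  {G : Perm4 → Bool} (G-subgroup : IsSubgroupS4 G) (i : Fin 4)
  {ρ : Perm4 → Mat2 p} (ρ-rep : IsRep p G ρ) (no-invariants : NoInvariants p G ρ)
  (v : V2 p) (v≢0 : v ≢ zeroV p)
  (H⊆Stab : ∀ σ → InPointStab G i σ → InStab p G ρ v σ)
  (Stab⊆Fix : ∀ σ → InStab p G ρ v σ → InFix p G ρ v σ) where

  open OddPrimeField p p-prime 2<p
  open Plane p
  open IsSubgroupS4 G-subgroup
  open IsRep ρ-rep
  open Subgroup G-subgroup
  open Algebra.Solver.CommutativeMonoid +ᵥ-commutativeMonoid using (id; _⊜_) renaming (_⊕_ to _⊞_; solve to solve-+ᵥ)
  open ≡-Reasoning

  act-∘ : ∀ {σ τ} → G σ ≡ true → G τ ≡ true → ∀ w → ρ (σ ∘ₚ τ) $ₘ w ≡ ρ σ $ₘ ρ τ $ₘ w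
  act-∘ {σ} {τ} Gσ Gτ w = trans (cong (_$ₘ w) (rep-∘ σ τ Gσ Gτ)) ($ₘ-*ₘ (ρ σ) (ρ τ) w)

  act-id : ∀ w → ρ idₚ $ₘ w ≡ w
  act-id w = trans (cong (_$ₘ w) rep-id) (I-$ₘ w)

  ρ-involution : ∀ {u} → G u ≡ true → u ∘ₚ u ≡ idₚ → ρ u *ₘ ρ u ≡ I
  ρ-involution {u} Gu u²≡id = trans (sym (rep-∘ u u Gu Gu)) (trans (cong ρ u²≡id) rep-id)

  Stab-fixes-v : ∀ {σ} → InStab p G ρ v σ → ρ σ $ₘ v ≡ v
  Stab-fixes-v {σ} σ∈Stab = proj₂ (Stab⊆Fix σ σ∈Stab) v (1# , sym (·-identityˡ v))

  H-fixes-v : ∀ {σ} → InPointStab G i σ → ρ σ $ₘ v ≡ v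
  H-fixes-v {σ} σ∈H = Stab-fixes-v (H⊆Stab σ σ∈H)

  ¬negates-v : ∀ {σ} → G σ ≡ true → ρ σ $ₘ v ≢ - 1# · v
  ¬negates-v {σ} Gσ σv≡-v = v≢0 (w≡-w⇒w≡0 v (trans (sym (Stab-fixes-v σ∈Stab)) σv≡-v))
    where
    σ-scales : ∀ c → ρ σ $ₘ (c · v) ≡ (c * - 1#) · v
    σ-scales c = begin
      ρ σ $ₘ (c · v)   ≡⟨ $ₘ-· (ρ σ) c v ⟩
      c · ρ σ $ₘ v     ≡⟨ cong (c ·_) σv≡-v ⟩
      c · - 1# · v     ≡⟨ ·-assoc c (- 1#) v ⟩
      (c * - 1#) · v   ∎
    σ∈Stab : InStab p G ρ v σ
    σ∈Stab = Gσ
      , (λ where _ (c , refl) → c * - 1# , σ-scales c)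
      , (λ where _ (c , refl) → (c * - 1#) · v , (c * - 1# , refl) , trans (σ-scales (c * - 1#)) (cong (_· v) (c*-1*-1≡c c)))
      where
      c*-1*-1≡c : ∀ c → c * - 1# * - 1# ≡ c
      c*-1*-1≡c c = solve 1 (λ c → c :* :- con 1ℤ :* :- con 1ℤ := c) refl c

  involution-det1⇒trivial : ∀ {u} → G u ≡ true → u ∘ₚ u ≡ idₚ → det (ρ u) ≡ 1# → ρ u ≡ I
  involution-det1⇒trivial {u} Gu u²≡id det≡1 =
    [ (λ ρu≡I → ρu≡I) , (λ ρu≡-I → ⊥-elim (¬negates-v Gu (trans (cong (_$ₘ v) ρu≡-I) (-I-$ₘ v)))) ]′
    (involution-det1≡±I (ρ u) (ρ-involution Gu u²≡id) det≡1)

  module KleinCase (klein⊆G : KleinSubgroup⊆ G) where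

    term : Fin 4 → V
    term k = ρ (klein k) $ₘ v

    -- klein (i ⊕ j) is the element of V₄ taking i to j, so these elements
    -- represent the cosets of H and ρ σ permutes the terms of the transfer.
    translate-term : ∀ {σ} → G σ ≡ true → ∀ j → ρ σ $ₘ term (i ⊕ j) ≡ term (i ⊕ lookup σ j)
    translate-term {σ} Gσ j = begin
      ρ σ $ₘ ρ t $ₘ v     ≡⟨ act-∘ Gσ (klein⊆G (i ⊕ j)) v ⟨
      ρ (σ ∘ₚ t) $ₘ v     ≡⟨ cong (λ τ → ρ τ $ₘ v) σ∘t≡t′∘h ⟩
      ρ (t′ ∘ₚ h) $ₘ v    ≡⟨ act-∘ (klein⊆G (i ⊕ lookup σ j)) Gh v ⟩
      ρ t′ $ₘ ρ h $ₘ v    ≡⟨ cong (ρ t′ $ₘ_) (H-fixes-v (Gh , h-fixes-i)) ⟩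
      ρ t′ $ₘ v           ∎
      where
      t t′ h : Perm4
      t  = klein (i ⊕ j)
      t′ = klein (i ⊕ lookup σ j)
      h  = t′ ∘ₚ (σ ∘ₚ t)
      Gh : G h ≡ true
      Gh = closed-∘ t′ (σ ∘ₚ t) (klein⊆G (i ⊕ lookup σ j)) (closed-∘ σ t Gσ (klein⊆G (i ⊕ j)))
      σ∘t≡t′∘h : σ ∘ₚ t ≡ t′ ∘ₚ h
      σ∘t≡t′∘h = begin
        σ ∘ₚ t                   ≡⟨ ∘ₚ-identityˡ (σ ∘ₚ t) ⟨
        idₚ ∘ₚ (σ ∘ₚ t)          ≡⟨ cong (_∘ₚ (σ ∘ₚ t)) (klein-involutive (i ⊕ lookup σ j)) ⟨
        (t′ ∘ₚ t′) ∘ₚ (σ ∘ₚ t)   ≡⟨ ∘ₚ-assoc t′ t′ (σ ∘ₚ t) ⟩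
        t′ ∘ₚ h                  ∎
      h-fixes-i : lookup h i ≡ i
      h-fixes-i = begin
        lookup h i                           ≡⟨ lookup-∘ₚ t′ (σ ∘ₚ t) i ⟩
        lookup t′ (lookup (σ ∘ₚ t) i)        ≡⟨ cong (lookup t′) (lookup-∘ₚ σ t i) ⟩
        lookup t′ (lookup σ (i ⊕ (i ⊕ j)))   ≡⟨ cong (λ k → lookup t′ (lookup σ k)) (⊕-cancelˡ i j) ⟩
        lookup σ j ⊕ (i ⊕ lookup σ j)        ≡⟨ ⊕-swap i (lookup σ j) ⟩
        i                                    ∎

    transfer : V
    transfer = sum (λ j → term (i ⊕ j))

    transfer-invariant : ∀ σ → G σ ≡ true → ρ σ $ₘ transfer ≡ transfer
    transfer-invariant σ Gσ = begin
      ρ σ $ₘ transfer                     ≡⟨ $ₘ-sum (ρ σ) (λ j → term (i ⊕ j)) ⟩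
      sum (λ j → ρ σ $ₘ term (i ⊕ j))     ≡⟨ sum-cong-≗ (translate-term Gσ) ⟩
      sum (λ j → term (i ⊕ lookup σ j))   ≡⟨ sum-permute (λ j → term (i ⊕ j)) σ-permutation ⟨
      transfer                            ∎
      where
      σ-permutation : Permutation′ 4
      σ-permutation = bijection⇒permutation {σ} (members-bij σ Gσ)

    sum-term≡0 : sum term ≡ 0ᵥ
    sum-term≡0 = trans (sum-permute term (translation i)) (no-invariants transfer transfer-invariant)

    term-invariant : ∀ k → ρ (klein k) ≡ I → ∀ b → term (b ⊕ k) ≡ term b
    term-invariant k ρk≡I b = begin
      ρ (klein (b ⊕ k)) $ₘ v        ≡⟨ cong (λ τ → ρ τ $ₘ v) (klein-∘ k b) ⟨
      ρ (klein k ∘ₚ klein b) $ₘ v   ≡⟨ act-∘ (klein⊆G k) (klein⊆G b) v ⟩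
      ρ (klein k) $ₘ term b         ≡⟨ cong (_$ₘ term b) ρk≡I ⟩
      I $ₘ term b                   ≡⟨ I-$ₘ (term b) ⟩
      term b                        ∎

    sum-term≢double : ∀ b → sum term ≢ (term 0F +ᵥ term b) +ᵥ (term 0F +ᵥ term b)
    sum-term≢double b sum≡double = ¬negates-v (klein⊆G b) (begin
      term b           ≡⟨ u+w≡0⇒w≡-u (term 0F) (term b) pair≡0 ⟩
      - 1# · term 0F   ≡⟨ cong (- 1# ·_) (act-id v) ⟩
      - 1# · v         ∎)
      where
      pair≡0 : term 0F +ᵥ term b ≡ 0ᵥ
      pair≡0 = w≡-w⇒w≡0 _ (u+w≡0⇒w≡-u _ _ (trans (sym sum≡double) sum-term≡0))

    ρ-klein≢I : ∀ k → k ≢ 0F → ρ (klein k) ≢ I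
    ρ-klein≢I 0F k≢0 _ = k≢0 refl
    ρ-klein≢I 1F _ ρ₁≡I = sum-term≢double 2F (begin
      sum term
        ≡⟨ cong₂ (λ a b → term 0F +ᵥ (a +ᵥ (term 2F +ᵥ (b +ᵥ 0ᵥ)))) (invariant 0F) (invariant 2F) ⟩
      term 0F +ᵥ (term 0F +ᵥ (term 2F +ᵥ (term 2F +ᵥ 0ᵥ)))
        ≡⟨ solve-+ᵥ 2 (λ x y → x ⊞ (x ⊞ (y ⊞ (y ⊞ id))) ⊜ (x ⊞ y) ⊞ (x ⊞ y)) refl (term 0F) (term 2F) ⟩
      (term 0F +ᵥ term 2F) +ᵥ (term 0F +ᵥ term 2F) ∎)
      where
      invariant : ∀ b → term (b ⊕ 1F) ≡ term b
      invariant = term-invariant 1F ρ₁≡I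
    ρ-klein≢I 2F _ ρ₂≡I = sum-term≢double 1F (begin
      sum term
        ≡⟨ cong₂ (λ a b → term 0F +ᵥ (term 1F +ᵥ (a +ᵥ (b +ᵥ 0ᵥ)))) (invariant 0F) (invariant 1F) ⟩
      term 0F +ᵥ (term 1F +ᵥ (term 0F +ᵥ (term 1F +ᵥ 0ᵥ)))
        ≡⟨ solve-+ᵥ 2 (λ x y → x ⊞ (y ⊞ (x ⊞ (y ⊞ id))) ⊜ (x ⊞ y) ⊞ (x ⊞ y)) refl (term 0F) (term 1F) ⟩
      (term 0F +ᵥ term 1F) +ᵥ (term 0F +ᵥ term 1F) ∎)
      where
      invariant : ∀ b → term (b ⊕ 2F) ≡ term b
      invariant = term-invariant 2F ρ₂≡I
    ρ-klein≢I 3F _ ρ₃≡I = sum-term≢double 1F (begin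
      sum term
        ≡⟨ cong₂ (λ a b → term 0F +ᵥ (term 1F +ᵥ (a +ᵥ (b +ᵥ 0ᵥ)))) (invariant 1F) (invariant 0F) ⟩
      term 0F +ᵥ (term 1F +ᵥ (term 1F +ᵥ (term 0F +ᵥ 0ᵥ)))
        ≡⟨ solve-+ᵥ 2 (λ x y → x ⊞ (y ⊞ (y ⊞ (x ⊞ id))) ⊜ (x ⊞ y) ⊞ (x ⊞ y)) refl (term 0F) (term 1F) ⟩
      (term 0F +ᵥ term 1F) +ᵥ (term 0F +ᵥ term 1F) ∎)
      where
      invariant : ∀ b → term (b ⊕ 3F) ≡ term b
      invariant = term-invariant 3F ρ₃≡I

    impossible : ⊥
    impossible =
      [ (λ d₁≡1 → ρ-klein≢I 1F (λ ()) (trivial 1F d₁≡1))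
      , (λ d₁≡-1 → [ (λ d₂≡1 → ρ-klein≢I 2F (λ ()) (trivial 2F d₂≡1))
                   , (λ d₂≡-1 → ρ-klein≢I 3F (λ ()) (trivial 3F (d₃≡1 d₁≡-1 d₂≡-1))) ]′ (det≡±1 2F)) ]′
      (det≡±1 1F)
      where
      trivial : ∀ k → det (ρ (klein k)) ≡ 1# → ρ (klein k) ≡ I
      trivial k = involution-det1⇒trivial (klein⊆G k) (klein-involutive k)
      det≡±1 : ∀ k → det (ρ (klein k)) ≡ 1# ⊎ det (ρ (klein k)) ≡ - 1#
      det≡±1 k = det-involution≡±1 (ρ (klein k)) (ρ-involution (klein⊆G k) (klein-involutive k))
      d₃≡1 : det (ρ (klein 1F)) ≡ - 1# → det (ρ (klein 2F)) ≡ - 1# → det (ρ (klein 3F)) ≡ 1#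
      d₃≡1 d₁≡-1 d₂≡-1 = begin
        det (ρ (klein 3F))                        ≡⟨ cong det (rep-∘ (klein 1F) (klein 2F) (klein⊆G 1F) (klein⊆G 2F)) ⟩
        det (ρ (klein 1F) *ₘ ρ (klein 2F))        ≡⟨ det-*ₘ (ρ (klein 1F)) (ρ (klein 2F)) ⟩
        det (ρ (klein 1F)) * det (ρ (klein 2F))   ≡⟨ cong₂ _*_ d₁≡-1 d₂≡-1 ⟩
        - 1# * - 1#                               ≡⟨ solve 0 (:- con 1ℤ :* :- con 1ℤ := con 1ℤ) refl ⟩
        1#                                        ∎

  module FourCycleCase (g : Perm4) (g∈cycles : g ∈ fourCycles) (Gg : G g ≡ true)
                       (G⊆⟨g⟩ : ∀ σ → G σ ≡ true → InPowers g σ) where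

    g-fixed⇒0 : ∀ w → ρ g $ₘ w ≡ w → w ≡ 0ᵥ
    g-fixed⇒0 w gw≡w = no-invariants w λ σ Gσ → fixed-by-powers (G⊆⟨g⟩ σ Gσ)
      where
      power-fixes : ∀ k → ρ (power g k) $ₘ w ≡ w
      power-fixes 0F = act-id w
      power-fixes 1F = gw≡w
      power-fixes 2F = trans (act-∘ Gg Gg w) (trans (cong (ρ g $ₘ_) gw≡w) gw≡w)
      power-fixes 3F = trans (act-∘ Gg (power-∈ Gg 2F) w) (trans (cong (ρ g $ₘ_) (power-fixes 2F)) gw≡w)
      fixed-by-powers : ∀ {σ} → InPowers g σ → ρ σ $ₘ w ≡ w
      fixed-by-powers (k , refl) = power-fixes k

    g² : Perm4
    g² = g ∘ₚ g

    d : F p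
    d = det (ρ g)

    Gg² : G g² ≡ true
    Gg² = power-∈ Gg 2F

    g²-involutive : g² ∘ₚ g² ≡ idₚ
    g²-involutive = sym (All.lookup power-+₄ g∈cycles 2F 2F)

    det-ρg²≡d² : det (ρ g²) ≡ d * d
    det-ρg²≡d² = trans (cong det (rep-∘ g g Gg Gg)) (det-*ₘ (ρ g) (ρ g))

    ρg²≢I : ρ g² ≢ I
    ρg²≢I ρg²≡I = ¬negates-v Gg (u+w≡0⇒w≡-u v (ρ g $ₘ v) (g-fixed⇒0 (v +ᵥ ρ g $ₘ v) (begin
      ρ g $ₘ (v +ᵥ ρ g $ₘ v)        ≡⟨ $ₘ-+ᵥ (ρ g) v (ρ g $ₘ v) ⟩
      ρ g $ₘ v +ᵥ ρ g $ₘ ρ g $ₘ v   ≡⟨ cong (ρ g $ₘ v +ᵥ_) (act-∘ Gg Gg v) ⟨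
      ρ g $ₘ v +ᵥ ρ g² $ₘ v         ≡⟨ cong (λ M → ρ g $ₘ v +ᵥ M $ₘ v) ρg²≡I ⟩
      ρ g $ₘ v +ᵥ I $ₘ v            ≡⟨ cong (ρ g $ₘ v +ᵥ_) (I-$ₘ v) ⟩
      ρ g $ₘ v +ᵥ v                 ≡⟨ CommutativeMonoid.comm +ᵥ-commutativeMonoid (ρ g $ₘ v) v ⟩
      v +ᵥ ρ g $ₘ v                 ∎)))

    d²≡±1 : d * d ≡ 1# ⊎ d * d ≡ - 1#
    d²≡±1 = x*x≡1⇒x≡±1 (begin
      (d * d) * (d * d)         ≡⟨ cong₂ _*_ det-ρg²≡d² det-ρg²≡d² ⟨
      det (ρ g²) * det (ρ g²)   ≡⟨ det-*ₘ (ρ g²) (ρ g²) ⟨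
      det (ρ g² *ₘ ρ g²)        ≡⟨ cong det (ρ-involution Gg² g²-involutive) ⟩
      det I                     ≡⟨ det-I ⟩
      1#                        ∎)

    p%4≡1 : p % 4 ≡ 1
    p%4≡1 = [ (λ d²≡1 → ⊥-elim (ρg²≢I (involution-det1⇒trivial Gg² g²-involutive (trans det-ρg²≡d² d²≡1))))
            , square≡-1⇒p%4≡1 d ]′ d²≡±1

  fourCycle⇒p%4≡1 : GeneratedByFourCycle G → p % 4 ≡ 1
  fourCycle⇒p%4≡1 (g , g∈cycles , Gg , G⊆⟨g⟩) = FourCycleCase.p%4≡1 g g∈cycles Gg G⊆⟨g⟩

proposition7p14 : (p : ℕ) .{{_ : NonZero p}} → Prime p → 2 < p
    → (G : Perm4 → Bool) → IsSubgroupS4 G → IsTransitive G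
    → Coprime (order G) p
    → (i : Fin 4)
    → ∃[ ρ ] (IsRep p G ρ × IsExtremal p G i ρ)
    → (p % 4 ≡ 1) × IsoToC4 G × (∀ σ → InPointStab G i σ → σ ≡ idₚ)
proposition7p14 p p-prime 2<p G G-subgroup transitive _ i (ρ , ρ-rep , no-invariants , v , v≢0 , H⊆Stab , Stab⇔Fix) =
  [ klein-case , four-cycle-case ]′ (transitive⇒klein⊆⊎fourCycle transitive)
  where
  open Subgroup G-subgroup
  open Representation p p-prime 2<p G-subgroup i ρ-rep no-invariants v v≢0 H⊆Stab (proj₁ ∘ Stab⇔Fix)
  Conclusion : Set
  Conclusion = (p % 4 ≡ 1) × IsoToC4 G × (∀ σ → InPointStab G i σ → σ ≡ idₚ)
  klein-case : KleinSubgroup⊆ G → Conclusion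
  klein-case klein⊆G = ⊥-elim (KleinCase.impossible klein⊆G)
  four-cycle-case : GeneratedByFourCycle G → Conclusion
  four-cycle-case cyclic = fourCycle⇒p%4≡1 cyclic , fourCycle⇒IsoToC4 cyclic , fourCycle⇒stabilizer-trivial cyclic i
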